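{- Let $\gamma=\begin{pmatrix}a&b\\c&d\end{pmatrix}\in SL_2(\mathbb{Z})$ be written as $\gamma=(ST^{l_v})\cdots(ST^{l_1})(ST^{l_0})$ with integers $l_0,\dots,l_v$ ($v\ge0$) satisfying $(-1)^{j-1}l_j>0$ for $1\le j\le v$. Then: if $l_0<0$, $|l_0l_1\cdots l_v|\le|d|$; if $l_0=0$, $|l_1\cdots l_v|\le|d-c|$; if $l_0>0$, $|l_0l_1\cdots l_v|\le|c|+|d|$.
   Context: $S=\begin{pmatrix}0&-1\\1&0\end{pmatrix}$, $T=\begin{pmatrix}1&1\\0&1\end{pmatrix}$. An empty product $l_1\cdots l_v$ (when $v=0$) equals $1$. -}

module Defs where

open import Data.Integer using (ℤ; +_; -_; _+_; _*_; _-_; _<_; _>_; ∣_∣; -[1+_])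
open import Data.Nat using (ℕ; zero; suc)
open import Data.List using (List; []; _∷_; foldl)
open import Data.Product using (_×_; _,_)
open import Data.Unit using (⊤)

record M2 : Set where
  constructor mat
  field
    a b c d : ℤ

_⊗_ : M2 → M2 → M2
mat a b c d ⊗ mat a' b' c' d' =
  mat (a * a' + b * c') (a * b' + b * d') (c * a' + d * c') (c * b' + d * d')

I₂ : M2
I₂ = mat (+ 1) (+ 0) (+ 0) (+ 1)

S : M2
S = mat (+ 0) (- (+ 1)) (+ 1) (+ 0)

T : M2
T = mat (+ 1) (+ 1) (+ 0) (+ 1)

Tinv : M2
Tinv = mat (+ 1) (- (+ 1)) (+ 0) (+ 1)

natPow : M2 → ℕ → M2
natPow A zero = I₂
natPow A (suc n) = A ⊗ natPow A n

Tpow : ℤ → M2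
Tpow (+ n) = natPow T n
Tpow -[1+ n ] = natPow Tinv (suc n)

ST^ : ℤ → M2
ST^ l = S ⊗ Tpow l

-- word l₀ [l₁,…,l_v]  ↦  (ST^{l_v}) ⋯ (ST^{l_1}) (ST^{l_0})
word : ℤ → List ℤ → M2
word l₀ ls = foldl (λ acc l → ST^ l ⊗ acc) (ST^ l₀) ls

-- sign condition (-1)^{j-1} l_j > 0 for 1 ≤ j ≤ v on the list [l₁,…,l_v]:
-- AltPos: first entry positive, then alternating; AltNeg: first negative.
AltPos AltNeg : List ℤ → Set
AltPos [] = ⊤
AltPos (l ∷ ls) = (l > + 0) × AltNeg ls
AltNeg [] = ⊤
AltNeg (l ∷ ls) = (l < + 0) × AltPos ls

prodℤ : List ℤ → ℤ
prodℤ [] = + 1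
prodℤ (l ∷ ls) = l * prodℤ ls

-- ST^l sends a column vector (x , y) to (- y , x + l y), and the second coordinate of
-- γ (x , y) is c x + d y, i.e. -d, c - d or c + d for (x , y) = (0 , -1), (1 , -1), (1 , 1).
-- For the matching choice, after the first letter ST^{l₀} the vector satisfies n ≤ y and
-- n ≤ x + y with n = |l₀| (n = 1 if l₀ = 0).  A positive letter l turns such a vector into
-- (- y , x + l y), whose first coordinate is ≤ 0 and whose second is ≥ n + (l - 1) y ≥ l n;
-- a negative letter -m turns a vector with x ≤ 0 and n ≤ y into -(y , m y - x), which
-- satisfies the first invariant with bound m n.  So every letter multiplies the lower bound
-- on the second coordinate by |l_j|.
module Submission where

open import Defs
open import Data.Integer
  using (ℤ; +_; -_; _+_; _-_; _*_; _≤_; _<_; _>_; ∣_∣; +[1+_]; -[1+_]; +≤+; +<+; nonNegative)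
import Data.Integer.Properties as ℤ
open import Data.Integer.Tactic.RingSolver using (solve-∀)
open import Data.Nat as ℕ using (ℕ; zero; suc; z≤n)
import Data.Nat.Properties as ℕ
open import Data.List using (List; []; _∷_; foldl)
open import Data.Product using (_×_; _,_; proj₁; proj₂; map)
open import Function using (_∘_)
open import Relation.Binary.PropositionalEquality
  using (_≡_; refl; sym; trans; cong; cong₂; subst; subst₂; module ≡-Reasoning)

mat-cong : ∀ {a b c d a′ b′ c′ d′} →
           a ≡ a′ → b ≡ b′ → c ≡ c′ → d ≡ d′ → mat a b c d ≡ mat a′ b′ c′ d′
mat-cong refl refl refl refl = refl

translation : ℤ → M2
translation l = mat (+ 1) l (+ 0) (+ 1)

translation-⊗ : ∀ l m → translation l ⊗ translation m ≡ translation (l + m)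
translation-⊗ l m = mat-cong (a-entry l) (b-entry l m) refl refl
  where
  a-entry : ∀ l → + 1 * + 1 + l * + 0 ≡ + 1
  a-entry = solve-∀
  b-entry : ∀ l m → + 1 * m + l * + 1 ≡ l + m
  b-entry = solve-∀

natPow-T : ∀ n → natPow T n ≡ translation (+ n)
natPow-T zero    = refl
natPow-T (suc n) = trans (cong (T ⊗_) (natPow-T n)) (translation-⊗ (+ 1) (+ n))

natPow-Tinv : ∀ n → natPow Tinv (suc n) ≡ translation -[1+ n ]
natPow-Tinv zero    = refl
natPow-Tinv (suc n) =
  trans (cong (Tinv ⊗_) (natPow-Tinv n)) (translation-⊗ -[1+ 0 ] -[1+ n ])

Tpow≡translation : ∀ l → Tpow l ≡ translation l
Tpow≡translation (+ n)    = natPow-T n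
Tpow≡translation -[1+ n ] = natPow-Tinv n

infixr 7 _·_

_·_ : M2 → ℤ × ℤ → ℤ × ℤ
mat a b c d · (x , y) = a * x + b * y , c * x + d * y

·-⊗ : ∀ A B v → (A ⊗ B) · v ≡ A · B · v
·-⊗ (mat a b c d) (mat a′ b′ c′ d′) (x , y) =
  cong₂ _,_ (row a b a′ b′ c′ d′ x y) (row c d a′ b′ c′ d′ x y)
  where
  row : ∀ p q a′ b′ c′ d′ x y → (p * a′ + q * c′) * x + (p * b′ + q * d′) * y
                              ≡ p * (a′ * x + b′ * y) + q * (c′ * x + d′ * y)
  row = solve-∀

ST-step : ℤ → ℤ × ℤ → ℤ × ℤ
ST-step l (x , y) = - y , x + l * y

ST-steps : List ℤ → ℤ × ℤ → ℤ × ℤ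
ST-steps []       v = v
ST-steps (l ∷ ls) v = ST-steps ls (ST-step l v)

ST^-· : ∀ l v → ST^ l · v ≡ ST-step l v
ST^-· l (x , y) = begin
  (S ⊗ Tpow l) · (x , y)       ≡⟨ ·-⊗ S (Tpow l) (x , y) ⟩
  S · Tpow l · (x , y)         ≡⟨ cong (λ A → S · A · (x , y)) (Tpow≡translation l) ⟩
  S · translation l · (x , y)  ≡⟨ cong₂ _,_ (first l x y) (second l x y) ⟩
  ST-step l (x , y)            ∎
  where
  open ≡-Reasoning
  first : ∀ l x y → + 0 * (+ 1 * x + l * y) + - + 1 * (+ 0 * x + + 1 * y) ≡ - y
  first = solve-∀
  second : ∀ l x y → + 1 * (+ 1 * x + l * y) + + 0 * (+ 0 * x + + 1 * y) ≡ x + l * y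
  second = solve-∀

·-foldl-ST^ : ∀ A ls v → foldl (λ acc l → ST^ l ⊗ acc) A ls · v ≡ ST-steps ls (A · v)
·-foldl-ST^ A []       v = refl
·-foldl-ST^ A (l ∷ ls) v = begin
  foldl (λ acc l → ST^ l ⊗ acc) (ST^ l ⊗ A) ls · v  ≡⟨ ·-foldl-ST^ (ST^ l ⊗ A) ls v ⟩
  ST-steps ls ((ST^ l ⊗ A) · v)                    ≡⟨ cong (ST-steps ls) (·-⊗ (ST^ l) A v) ⟩
  ST-steps ls (ST^ l · A · v)                      ≡⟨ cong (ST-steps ls) (ST^-· l (A · v)) ⟩
  ST-steps ls (ST-step l (A · v))                  ∎
  where open ≡-Reasoning

word-· : ∀ l₀ ls v → word l₀ ls · v ≡ ST-steps (l₀ ∷ ls) v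
word-· l₀ ls v = trans (·-foldl-ST^ (ST^ l₀) ls v) (cong (ST-steps ls) (ST^-· l₀ v))

ST-step-neg : ∀ l v → ST-step l (map -_ -_ v) ≡ map -_ -_ (ST-step l v)
ST-step-neg l (x , y) = cong (- - y ,_) (linear x y l)
  where
  linear : ∀ x y l → - x + l * - y ≡ - (x + l * y)
  linear = solve-∀

ST-steps-neg : ∀ ls v → ST-steps ls (map -_ -_ v) ≡ map -_ -_ (ST-steps ls v)
ST-steps-neg []       v = refl
ST-steps-neg (l ∷ ls) v =
  trans (cong (ST-steps ls) (ST-step-neg l v)) (ST-steps-neg ls (ST-step l v))

∣ST-steps-neg∣ : ∀ ls v → ∣ proj₂ (ST-steps ls (map -_ -_ v)) ∣ ≡ ∣ proj₂ (ST-steps ls v) ∣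
∣ST-steps-neg∣ ls v =
  trans (cong (∣_∣ ∘ proj₂) (ST-steps-neg ls v)) (ℤ.∣-i∣≡∣i∣ (proj₂ (ST-steps ls v)))

ST-step-neg-exponent : ∀ m x y → ST-step (- m) (x , y) ≡ map -_ -_ (y , - x + m * y)
ST-step-neg-exponent m x y = cong₂ _,_ refl (linear x y m)
  where
  linear : ∀ x y m → x + - m * y ≡ - (- x + m * y)
  linear = solve-∀

Growing : ℕ → ℤ × ℤ → Set
Growing n (x , y) = + n ≤ y × + n ≤ x + y

ST-step-grows : ∀ k {n} v → Growing n v → + (suc k ℕ.* n) ≤ proj₂ (ST-step +[1+ k ] v)
ST-step-grows k {n} (x , y) (n≤y , n≤x+y) = begin
  + n + + (k ℕ.* n)    ≡⟨ cong (_+_ (+ n)) (ℤ.pos-* k n) ⟩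
  + n + + k * + n      ≤⟨ ℤ.+-mono-≤ n≤x+y (ℤ.*-monoˡ-≤-nonNeg (+ k) n≤y) ⟩
  (x + y) + + k * y    ≡⟨ regroup x y (+ k) ⟩
  x + +[1+ k ] * y     ∎
  where
  open ℤ.≤-Reasoning
  regroup : ∀ x y k → (x + y) + k * y ≡ x + (+ 1 + k) * y
  regroup = solve-∀

+≤⇒≤∣∣ : ∀ {n i} → + n ≤ i → n ℕ.≤ ∣ i ∣
+≤⇒≤∣∣ (+≤+ n≤m) = n≤m

*-∣*∣ : ∀ n l p → n ℕ.* ∣ l * p ∣ ≡ ∣ l ∣ ℕ.* n ℕ.* ∣ p ∣
*-∣*∣ n l p = begin
  n ℕ.* ∣ l * p ∣          ≡⟨ cong (n ℕ.*_) (ℤ.abs-* l p) ⟩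
  n ℕ.* (∣ l ∣ ℕ.* ∣ p ∣)  ≡⟨ sym (ℕ.*-assoc n ∣ l ∣ ∣ p ∣) ⟩
  n ℕ.* ∣ l ∣ ℕ.* ∣ p ∣    ≡⟨ cong (ℕ._* ∣ p ∣) (ℕ.*-comm n ∣ l ∣) ⟩
  ∣ l ∣ ℕ.* n ℕ.* ∣ p ∣    ∎
  where open ≡-Reasoning

mutual
  growth⁺ : ∀ {ls n} v → AltPos ls → Growing n v →
            n ℕ.* ∣ prodℤ ls ∣ ℕ.≤ ∣ proj₂ (ST-steps ls v) ∣
  growth⁺ {[]} {n} (_ , y) _ (n≤y , _) =
    subst (ℕ._≤ ∣ y ∣) (sym (ℕ.*-identityʳ n)) (+≤⇒≤∣∣ n≤y)
  growth⁺ {+[1+ k ] ∷ ls} {n} v (_ , alt) g@(n≤y , _) =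
    ℕ.≤-trans (ℕ.≤-reflexive (*-∣*∣ n +[1+ k ] (prodℤ ls)))
      (growth⁻ (ST-step +[1+ k ] v) alt
        (ℤ.neg-mono-≤ (ℤ.≤-trans (+≤+ z≤n) n≤y)) (ST-step-grows k v g))
  growth⁺ {+ 0 ∷ _}       _ (+<+ () , _) _
  growth⁺ { -[1+ _ ] ∷ _} _ (() , _)     _

  growth⁻ : ∀ {ls n} v → AltNeg ls → proj₁ v ≤ + 0 → + n ≤ proj₂ v →
            n ℕ.* ∣ prodℤ ls ∣ ℕ.≤ ∣ proj₂ (ST-steps ls v) ∣
  growth⁻ {[]} {n} (_ , y) _ _ n≤y =
    subst (ℕ._≤ ∣ y ∣) (sym (ℕ.*-identityʳ n)) (+≤⇒≤∣∣ n≤y)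
  growth⁻ { -[1+ k ] ∷ ls} {n} (x , y) (_ , alt) x≤0 n≤y =
    ℕ.≤-trans (ℕ.≤-reflexive (*-∣*∣ n -[1+ k ] (prodℤ ls)))
      (subst (_ ℕ.≤_) mirror (growth⁺ w alt (grows , ℤ.i≤j⇒i≤k+j y {{nonNegative 0≤y}} grows)))
    where
    0≤y : + 0 ≤ y
    0≤y = ℤ.≤-trans (+≤+ z≤n) n≤y
    w : ℤ × ℤ
    w = y , - x + +[1+ k ] * y
    grows : + (suc k ℕ.* n) ≤ proj₂ w
    grows = ST-step-grows k (- x , y)
              (n≤y , ℤ.i≤j⇒i≤k+j (- x) {{nonNegative (ℤ.neg-mono-≤ x≤0)}} n≤y)
    mirror : ∣ proj₂ (ST-steps ls w) ∣ ≡ ∣ proj₂ (ST-steps ls (ST-step -[1+ k ] (x , y))) ∣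
    mirror = sym (trans (cong (∣_∣ ∘ proj₂ ∘ ST-steps ls) (ST-step-neg-exponent +[1+ k ] x y))
                        (∣ST-steps-neg∣ ls w))
  growth⁻ {+ _ ∷ _} _ (+<+ () , _) _ _

word-growth : ∀ l₀ {ls n} v → AltPos ls → Growing n (ST-step l₀ v) →
              n ℕ.* ∣ prodℤ ls ∣ ℕ.≤ ∣ proj₂ (word l₀ ls · v) ∣
word-growth l₀ {ls} v alt g =
  subst (λ u → _ ℕ.≤ ∣ proj₂ u ∣) (sym (word-· l₀ ls v)) (growth⁺ (ST-step l₀ v) alt g)

first-step⁻ : ∀ {l} → l < + 0 → Growing ∣ l ∣ (ST-step l (+ 0 , - + 1))
first-step⁻ { -[1+ k ]} _ =
  subst (Growing (suc k) ∘ (+ 1 ,_)) (sym (second -[1+ k ])) (ℤ.≤-refl , +≤+ (ℕ.n≤1+n (suc k)))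
  where
  second : ∀ l → + 0 + l * - + 1 ≡ - l
  second = solve-∀
first-step⁻ {+ _} (+<+ ())

first-step⁰ : ∀ {l} → l ≡ + 0 → Growing 1 (ST-step l (+ 1 , - + 1))
first-step⁰ refl = ℤ.≤-refl , +≤+ (ℕ.s≤s z≤n)

first-step⁺ : ∀ {l} → l > + 0 → Growing ∣ l ∣ (ST-step l (+ 1 , + 1))
first-step⁺ {+[1+ k ]} _ =
  subst (Growing (suc k) ∘ (- + 1 ,_)) (sym (cong (_+_ (+ 1)) (ℤ.*-identityʳ +[1+ k ])))
    (+≤+ (ℕ.n≤1+n (suc k)) , ℤ.≤-refl)
first-step⁺ {+ 0} (+<+ ())

∣·-probe-d∣ : ∀ M → ∣ proj₂ (M · (+ 0 , - + 1)) ∣ ≡ ∣ M2.d M ∣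
∣·-probe-d∣ (mat _ _ c d) = trans (cong ∣_∣ (neg c d)) (ℤ.∣-i∣≡∣i∣ d)
  where
  neg : ∀ c d → c * + 0 + d * - + 1 ≡ - d
  neg = solve-∀

∣·-probe-d-c∣ : ∀ M → ∣ proj₂ (M · (+ 1 , - + 1)) ∣ ≡ ∣ M2.d M - M2.c M ∣
∣·-probe-d-c∣ (mat _ _ c d) = trans (cong ∣_∣ (diff c d)) (ℤ.∣i-j∣≡∣j-i∣ c d)
  where
  diff : ∀ c d → c * + 1 + d * - + 1 ≡ c - d
  diff = solve-∀

·-probe-c+d : ∀ M → proj₂ (M · (+ 1 , + 1)) ≡ M2.c M + M2.d M
·-probe-c+d (mat _ _ c d) = sum c d
  where
  sum : ∀ c d → c * + 1 + d * + 1 ≡ c + d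
  sum = solve-∀

proposition3p7 : (a b c d l₀ : ℤ) (ls : List ℤ) →
    AltPos ls →
    mat a b c d ≡ word l₀ ls →
    (l₀ < + 0 → ∣ l₀ * prodℤ ls ∣ ℕ.≤ ∣ d ∣) ×
    ((l₀ ≡ + 0 → ∣ prodℤ ls ∣ ℕ.≤ ∣ d - c ∣) ×
     (l₀ > + 0 → ∣ l₀ * prodℤ ls ∣ ℕ.≤ ∣ c ∣ ℕ.+ ∣ d ∣))
proposition3p7 a b c d l₀ ls alt eq = bound-d , bound-d-c , bound-c+d
  where
  γ : M2
  γ = mat a b c d

  growth : ∀ {n} v → Growing n (ST-step l₀ v) → n ℕ.* ∣ prodℤ ls ∣ ℕ.≤ ∣ proj₂ (γ · v) ∣
  growth v g = subst (λ M → _ ℕ.≤ ∣ proj₂ (M · v) ∣) (sym eq) (word-growth l₀ v alt g)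

  ∣l₀*prod∣ : ∣ l₀ * prodℤ ls ∣ ≡ ∣ l₀ ∣ ℕ.* ∣ prodℤ ls ∣
  ∣l₀*prod∣ = ℤ.abs-* l₀ (prodℤ ls)

  bound-d : l₀ < + 0 → ∣ l₀ * prodℤ ls ∣ ℕ.≤ ∣ d ∣
  bound-d l₀<0 =
    subst₂ ℕ._≤_ (sym ∣l₀*prod∣) (∣·-probe-d∣ γ) (growth _ (first-step⁻ l₀<0))

  bound-d-c : l₀ ≡ + 0 → ∣ prodℤ ls ∣ ℕ.≤ ∣ d - c ∣
  bound-d-c l₀≡0 =
    subst₂ ℕ._≤_ (ℕ.*-identityˡ _) (∣·-probe-d-c∣ γ) (growth _ (first-step⁰ l₀≡0))

  bound-c+d : l₀ > + 0 → ∣ l₀ * prodℤ ls ∣ ℕ.≤ ∣ c ∣ ℕ.+ ∣ d ∣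
  bound-c+d l₀>0 = ℕ.≤-trans
    (subst₂ ℕ._≤_ (sym ∣l₀*prod∣) (cong ∣_∣ (·-probe-c+d γ)) (growth _ (first-step⁺ l₀>0)))
    (ℤ.∣i+j∣≤∣i∣+∣j∣ c d)
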